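{- Let $s \geq 6$ and $N$ be positive integers, and let $A=\{0=a_1, a_2,\ldots, a_s \} \subseteq \{0,1,\ldots,N-1\}$ be a set of $s$ distinct integers with $\gcd(a_2, \ldots, a_s)=1$. Let $x_1, \ldots, x_s$ be integers such that for all indices $i,j,k,l\in\{1,\ldots,s\}$, $$a_j-a_i=a_k-a_l \implies x_j-x_i=x_k-x_l.$$ If $|A+A|<\frac{5}{2}s$, then there exist integers $x,y$ such that $x_i=a_ix+y$ for each $i=1,\ldots,s$.
   Context: $A+A=\{a+b: a,b\in A\}$. -}

module Defs where

open import Data.Nat using (ℕ; zero; suc; _+_; _*_; _≟_)
open import Data.Nat.GCD using (gcd)
open import Data.Fin using (Fin)
open import Data.Fin.Properties using (any?)
open import Data.List using (List; filter; length; upTo; foldr; map)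
open import Data.Product using (∃; ∃-syntax)
open import Relation.Binary.PropositionalEquality using (_≡_)
open import Relation.Nullary using (Dec)

InSumset : {s : ℕ} → (Fin s → ℕ) → ℕ → Set
InSumset a n = ∃[ i ] ∃[ j ] (a i + a j ≡ n)

inSumset? : {s : ℕ} (a : Fin s → ℕ) (n : ℕ) → Dec (InSumset a n)
inSumset? a n = any? (λ i → any? (λ j → a i + a j ≟ n))

-- |A + A| for A = {a i} ⊆ {0,…,N-1}: all sums lie in {0,…,2N-1}
sumsetSize : {s : ℕ} → ℕ → (Fin s → ℕ) → ℕ
sumsetSize N a = length (filter (inSumset? a) (upTo (2 * N)))

gcdList : List ℕ → ℕ
gcdList = foldr gcd 0

module Submission where

-- Read the points (aᵢ, xᵢ) as a subset P of ℤ². The difference hypothesis makes the projection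
-- P → A a Freiman isomorphism, so |P + P| = |A + A| < 5s/2. Freiman's lemma in the plane says
-- that a set of k points that is not contained in a line has |P + P| ≥ 3k − 3; it is proved by
-- induction on the points ordered by abscissa: adding a new leftmost point p creates at least
-- k new sums p + z when the remaining points are collinear, and otherwise at least three, namely
-- 2p and p + w for the two points w of the remaining convex hull that are tangent from p.
-- Since 3s − 3 ≥ 5s/2 for s ≥ 6, the points are collinear; the line passes through (0, x₁), so
-- aᵢ(xⱼ − x₁) = aⱼ(xᵢ − x₁), and the Bézout identity for gcd(a₂, …, aₛ) = 1 produces the slope.

open import Defs

module FilterLength {A : Set} where
  open import Data.Nat using (_+_; _≤_; _<_; z≤n; s≤s)
  open import Data.Nat.Properties
    using (m≤n⇒m≤1+n; +-suc; +-identityʳ; +-monoˡ-≤; ≤-trans; ≤-reflexive)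
  open import Data.List using ([]; _∷_; filter; length)
  open import Data.List.Membership.Propositional using (_∈_)
  open import Data.List.Relation.Unary.Any using (here; there)
  open import Data.List.Relation.Unary.All using (All; []; _∷_; zipWith)
  open import Data.List.Relation.Unary.Unique.Propositional using (Unique; []; _∷_)
  open import Data.Product using (_×_; _,_)
  open import Data.Sum using (_⊎_; inj₁; inj₂)
  open import Data.Empty using (⊥-elim)
  open import Relation.Nullary using (¬_; yes; no)
  open import Relation.Nullary.Decidable using (_⊎-dec_)
  open import Relation.Unary using (Pred; Decidable; _⊆_)
  open import Relation.Binary.Definitions using (DecidableEquality)
  open import Relation.Binary.PropositionalEquality using (_≡_; refl; sym)
  open import Level using (0ℓ)

  length-filter-mono : {P Q : Pred A 0ℓ} (P? : Decidable P) (Q? : Decidable Q) →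
    P ⊆ Q → ∀ xs → length (filter P? xs) ≤ length (filter Q? xs)
  length-filter-mono P? Q? P⊆Q [] = z≤n
  length-filter-mono P? Q? P⊆Q (x ∷ xs) with P? x | Q? x
  ... | yes _  | yes _  = s≤s (length-filter-mono P? Q? P⊆Q xs)
  ... | yes Px | no ¬Qx = ⊥-elim (¬Qx (P⊆Q Px))
  ... | no _   | yes _  = m≤n⇒m≤1+n (length-filter-mono P? Q? P⊆Q xs)
  ... | no _   | no _   = length-filter-mono P? Q? P⊆Q xs

  length-filter-mono-< : {P Q : Pred A 0ℓ} (P? : Decidable P) (Q? : Decidable Q) →
    P ⊆ Q → ∀ {x xs} → x ∈ xs → Q x → ¬ P x →
    length (filter P? xs) < length (filter Q? xs)
  length-filter-mono-< P? Q? P⊆Q {xs = y ∷ xs} (here refl) Qx ¬Px with P? y | Q? y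
  ... | yes Px | _      = ⊥-elim (¬Px Px)
  ... | no _   | yes _  = s≤s (length-filter-mono P? Q? P⊆Q xs)
  ... | no _   | no ¬Qx = ⊥-elim (¬Qx Qx)
  length-filter-mono-< P? Q? P⊆Q {xs = y ∷ xs} (there x∈xs) Qx ¬Px with P? y | Q? y
  ... | yes _  | yes _  = s≤s (length-filter-mono-< P? Q? P⊆Q x∈xs Qx ¬Px)
  ... | yes Py | no ¬Qy = ⊥-elim (¬Qy (P⊆Q Py))
  ... | no _   | yes _  = m≤n⇒m≤1+n (length-filter-mono-< P? Q? P⊆Q x∈xs Qx ¬Px)
  ... | no _   | no _   = length-filter-mono-< P? Q? P⊆Q x∈xs Qx ¬Px

  -- adding the elements of L to P one at a time, each addition lengthens the filter
  length-filter-extend : (_≟_ : DecidableEquality A) {P Q : Pred A 0ℓ}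
    (P? : Decidable P) (Q? : Decidable Q) → P ⊆ Q → ∀ xs {L} → Unique L →
    All (λ y → y ∈ xs × Q y × ¬ P y) L →
    length (filter P? xs) + length L ≤ length (filter Q? xs)
  length-filter-extend _≟_ P? Q? P⊆Q xs [] [] =
    ≤-trans (≤-reflexive (+-identityʳ _)) (length-filter-mono P? Q? P⊆Q xs)
  length-filter-extend _≟_ {P} {Q} P? Q? P⊆Q xs {y ∷ L} (y∉L ∷ unique) ((y∈xs , Qy , ¬Py) ∷ new) =
    ≤-trans (≤-reflexive (+-suc _ (length L)))
      (≤-trans (+-monoˡ-≤ (length L) (length-filter-mono-< P? P+y? inj₁ y∈xs (inj₂ refl) ¬Py))
               (length-filter-extend _≟_ P+y? Q? P+y⊆Q xs unique (still-new y∉L new)))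
    where
    P+y? : Decidable (λ z → P z ⊎ z ≡ y)
    P+y? z = P? z ⊎-dec (z ≟ y)
    P+y⊆Q : ∀ {z} → P z ⊎ z ≡ y → Q z
    P+y⊆Q (inj₁ Pz) = P⊆Q Pz
    P+y⊆Q (inj₂ refl) = Qy
    still-new : All (λ z → ¬ y ≡ z) L → All (λ z → z ∈ xs × Q z × ¬ P z) L →
      All (λ z → z ∈ xs × Q z × ¬ (P z ⊎ z ≡ y)) L
    still-new y∉L new = zipWith (λ { (y≢z , z∈xs , Qz , ¬Pz) →
      z∈xs , Qz , λ { (inj₁ Pz) → ¬Pz Pz ; (inj₂ z≡y) → y≢z (sym z≡y) } }) (y∉L , new)

module Plane where
  open import Data.Integer using (ℤ; 0ℤ; _+_; _-_; _*_; -_)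
  open import Data.Integer.Solver using (module +-*-Solver)
  open import Data.Integer.Properties using (*-zeroʳ; i*j≡0⇒i≡0∨j≡0; i-j≡0⇒i≡j)
  open import Data.Sum using ([_,_]′)
  open import Function using (id)
  open import Data.Empty using (⊥-elim)
  open import Data.Product using (_×_; _,_; proj₁)
  open import Relation.Binary.PropositionalEquality
    using (_≡_; _≢_; refl; cong; cong₂; trans; sym; module ≡-Reasoning)
  open ≡-Reasoning
  open +-*-Solver using (solve; _:=_; _:+_; _:-_; _:*_; :-_; con; Polynomial)

  Point : Set
  Point = ℤ × ℤ

  _⊕_ : Point → Point → Point
  (x₁ , y₁) ⊕ (x₂ , y₂) = (x₁ + x₂ , y₁ + y₂)

  reflect : Point → Point
  reflect (x , y) = (x , - y)

  -- twice the signed area of the triangle PQR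
  Δ : Point → Point → Point → ℤ
  Δ (x₁ , y₁) (x₂ , y₂) (x₃ , y₃) = (x₂ - x₁) * (y₃ - y₁) - (x₃ - x₁) * (y₂ - y₁)

  private
    Δₚ : ∀ {n} → Polynomial n → Polynomial n → Polynomial n → Polynomial n →
      Polynomial n → Polynomial n → Polynomial n
    Δₚ x₁ y₁ x₂ y₂ x₃ y₃ = (x₂ :- x₁) :* (y₃ :- y₁) :- (x₃ :- x₁) :* (y₂ :- y₁)

  Δ-cyclic : ∀ P Q R → Δ P Q R ≡ Δ Q R P
  Δ-cyclic (x₁ , y₁) (x₂ , y₂) (x₃ , y₃) = solve 6
    (λ x₁ y₁ x₂ y₂ x₃ y₃ → Δₚ x₁ y₁ x₂ y₂ x₃ y₃ := Δₚ x₂ y₂ x₃ y₃ x₁ y₁)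
    refl x₁ y₁ x₂ y₂ x₃ y₃

  Δ-swap : ∀ P Q R → Δ P Q R ≡ - Δ P R Q
  Δ-swap (x₁ , y₁) (x₂ , y₂) (x₃ , y₃) = solve 6
    (λ x₁ y₁ x₂ y₂ x₃ y₃ → Δₚ x₁ y₁ x₂ y₂ x₃ y₃ := :- Δₚ x₁ y₁ x₃ y₃ x₂ y₂)
    refl x₁ y₁ x₂ y₂ x₃ y₃

  Δ-repeat₁₂ : ∀ P R → Δ P P R ≡ 0ℤ
  Δ-repeat₁₂ (x₁ , y₁) (x₃ , y₃) = solve 4
    (λ x₁ y₁ x₃ y₃ → Δₚ x₁ y₁ x₁ y₁ x₃ y₃ := con 0ℤ) refl x₁ y₁ x₃ y₃

  Δ-repeat₂₃ : ∀ P Q → Δ P Q Q ≡ 0ℤ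
  Δ-repeat₂₃ (x₁ , y₁) (x₂ , y₂) = solve 4
    (λ x₁ y₁ x₂ y₂ → Δₚ x₁ y₁ x₂ y₂ x₂ y₂ := con 0ℤ) refl x₁ y₁ x₂ y₂

  Δ-repeat₁₃ : ∀ P Q → Δ P Q P ≡ 0ℤ
  Δ-repeat₁₃ P Q = trans (Δ-cyclic P Q P) (Δ-repeat₂₃ Q P)

  Δ-reflect : ∀ P Q R → Δ (reflect P) (reflect Q) (reflect R) ≡ - Δ P Q R
  Δ-reflect (x₁ , y₁) (x₂ , y₂) (x₃ , y₃) = solve 6
    (λ x₁ y₁ x₂ y₂ x₃ y₃ →
      Δₚ x₁ (:- y₁) x₂ (:- y₂) x₃ (:- y₃) := :- Δₚ x₁ y₁ x₂ y₂ x₃ y₃)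
    refl x₁ y₁ x₂ y₂ x₃ y₃

  Δ-additive : ∀ A B P Q → Δ A B (P ⊕ Q) + Δ A B (0ℤ , 0ℤ) ≡ Δ A B P + Δ A B Q
  Δ-additive (xa , ya) (xb , yb) (x₁ , y₁) (x₂ , y₂) = solve 8
    (λ xa ya xb yb x₁ y₁ x₂ y₂ →
      Δₚ xa ya xb yb (x₁ :+ x₂) (y₁ :+ y₂) :+ Δₚ xa ya xb yb (con 0ℤ) (con 0ℤ)
        := Δₚ xa ya xb yb x₁ y₁ :+ Δₚ xa ya xb yb x₂ y₂)
    refl xa ya xb yb x₁ y₁ x₂ y₂

  Δ-resp-⊕ : ∀ A B {P Q R S} → P ⊕ Q ≡ R ⊕ S → Δ A B P + Δ A B Q ≡ Δ A B R + Δ A B S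
  Δ-resp-⊕ A B {P} {Q} {R} {S} eq = trans (sym (Δ-additive A B P Q))
    (trans (cong (λ T → Δ A B T + Δ A B (0ℤ , 0ℤ)) eq) (Δ-additive A B R S))

  -- the x-coordinate form of the identity u×v w + v×w u + w×u v = 0 for plane vectors
  Δ-exchange : ∀ P Q W Z →
    (proj₁ W - proj₁ P) * Δ P Q Z ≡
    (proj₁ Z - proj₁ P) * Δ P Q W + (proj₁ Q - proj₁ P) * Δ P W Z
  Δ-exchange (xp , yp) (xq , yq) (xw , yw) (xz , yz) = solve 8
    (λ xp yp xq yq xw yw xz yz →
      (xw :- xp) :* Δₚ xp yp xq yq xz yz
        := (xz :- xp) :* Δₚ xp yp xq yq xw yw :+ (xq :- xp) :* Δₚ xp yp xw yw xz yz)
    refl xp yp xq yq xw yw xz yz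

  Δ-cocycle : ∀ P A B C → Δ A B C ≡ Δ P A B + Δ P B C + Δ P C A
  Δ-cocycle (xp , yp) (xa , ya) (xb , yb) (xc , yc) = solve 8
    (λ xp yp xa ya xb yb xc yc →
      Δₚ xa ya xb yb xc yc
        := Δₚ xp yp xa ya xb yb :+ Δₚ xp yp xb yb xc yc :+ Δₚ xp yp xc yc xa ya)
    refl xp yp xa ya xb yb xc yc

  Δ-through : ∀ {P W} Q Z → proj₁ P ≢ proj₁ W →
    Δ P W Q ≡ 0ℤ → Δ P W Z ≡ 0ℤ → Δ P Q Z ≡ 0ℤ
  Δ-through {P@(xp , _)} {W@(xw , _)} Q@(xq , _) Z@(xz , _) xp≢xw Q-on-PW Z-on-PW =
    [ (λ xw-xp≡0 → ⊥-elim (xp≢xw (sym (i-j≡0⇒i≡j xw xp xw-xp≡0)))) , id ]′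
      (i*j≡0⇒i≡0∨j≡0 (xw - xp) scaled)
    where
    scaled : (xw - xp) * Δ P Q Z ≡ 0ℤ
    scaled = begin
      (xw - xp) * Δ P Q Z
        ≡⟨ Δ-exchange P Q W Z ⟩
      (xz - xp) * Δ P Q W + (xq - xp) * Δ P W Z
        ≡⟨ cong₂ (λ u v → (xz - xp) * u + (xq - xp) * v)
                 (trans (Δ-swap P Q W) (cong -_ Q-on-PW)) Z-on-PW ⟩
      (xz - xp) * 0ℤ + (xq - xp) * 0ℤ
        ≡⟨ cong₂ _+_ (*-zeroʳ (xz - xp)) (*-zeroʳ (xq - xp)) ⟩
      0ℤ ∎

  Δ-origin : ∀ y₀ x₁ y₁ x₂ y₂ →
    Δ (0ℤ , y₀) (x₁ , y₁) (x₂ , y₂) ≡ x₁ * (y₂ - y₀) - x₂ * (y₁ - y₀)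
  Δ-origin = solve 5 (λ y₀ x₁ y₁ x₂ y₂ →
    Δₚ (con 0ℤ) y₀ x₁ y₁ x₂ y₂ := x₁ :* (y₂ :- y₀) :- x₂ :* (y₁ :- y₀)) refl

module Sumset where
  open import Data.Nat using (ℕ; _+_; _*_; _≤_; _<_; _≟_)
  open import Data.Nat.Properties using (+-mono-≤; +-mono-<; +-identityʳ; +-cancelˡ-≡; <⇒≱)
  open import Data.List using (List; _∷_; map; filter; length; upTo; cartesianProductWith)
  open import Data.List.Properties using (length-map)
  open import Data.List.Membership.Propositional using (_∈_; _∉_)
  open import Data.List.Membership.Propositional.Properties
    using (∈-cartesianProductWith⁺; ∈-cartesianProductWith⁻; ∈-upTo⁺)
  open import Data.List.Membership.DecPropositional _≟_ using (_∈?_)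
  open import Data.List.Relation.Unary.Any using (here; there)
  open import Data.List.Relation.Unary.All as All using (All)
  open import Data.List.Relation.Unary.All.Properties using (map⁺)
  open import Data.List.Relation.Unary.Unique.Propositional using (Unique)
  import Data.List.Relation.Unary.Unique.Propositional.Properties as Unique
  open import Data.List.Relation.Binary.Subset.Propositional using (_⊆_)
  open import Data.Product using (∃₂; _×_; _,_)
  open import Relation.Binary.PropositionalEquality using (_≡_; refl; subst; cong; sym)
  open FilterLength using (length-filter-extend)

  sums : List ℕ → List ℕ
  sums S = cartesianProductWith _+_ S S

  sumsetCount : ℕ → List ℕ → ℕ
  sumsetCount N S = length (filter (_∈? sums S) (upTo (2 * N)))

  ∈-sums⁺ : ∀ {S r u} → r ∈ S → u ∈ S → r + u ∈ sums S
  ∈-sums⁺ = ∈-cartesianProductWith⁺ _+_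

  ∈-sums⁻ : ∀ S {n} → n ∈ sums S → ∃₂ λ r u → r ∈ S × u ∈ S × n ≡ r + u
  ∈-sums⁻ S = ∈-cartesianProductWith⁻ _+_ S S

  sums-mono : ∀ {S T} → S ⊆ T → sums S ⊆ sums T
  sums-mono {S} S⊆T n∈S+S with ∈-sums⁻ S n∈S+S
  ... | r , u , r∈S , u∈S , refl = ∈-sums⁺ (S⊆T r∈S) (S⊆T u∈S)

  sums-≥ : ∀ {m S n} → All (m ≤_) S → n ∈ sums S → m + m ≤ n
  sums-≥ {S = S} m≤S n∈S+S with ∈-sums⁻ S n∈S+S
  ... | r , u , r∈S , u∈S , refl = +-mono-≤ (All.lookup m≤S r∈S) (All.lookup m≤S u∈S)

  sums-< : ∀ {N S n} → All (_< N) S → n ∈ sums S → n < 2 * N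
  sums-< {N} {S} S<N n∈S+S with ∈-sums⁻ S n∈S+S
  ... | r , u , r∈S , u∈S , refl =
    subst (r + u <_) (cong (N +_) (sym (+-identityʳ N)))
      (+-mono-< (All.lookup S<N r∈S) (All.lookup S<N u∈S))

  ∉-sums : ∀ {m S n} → All (m ≤_) S → n < m + m → n ∉ sums S
  ∉-sums m≤S n<2m n∈S+S = <⇒≱ n<2m (sums-≥ m≤S n∈S+S)

  sumsetCount-∷ : ∀ {N p S} → All (_< N) (p ∷ S) → ∀ {Z} → Unique Z →
    All (λ z → z ∈ p ∷ S × p + z ∉ sums S) Z →
    sumsetCount N S + length Z ≤ sumsetCount N (p ∷ S)
  sumsetCount-∷ {N} {p} {S} bounded {Z} unique new =
    subst (λ k → sumsetCount N S + k ≤ sumsetCount N (p ∷ S)) (length-map (p +_) Z)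
      (length-filter-extend _≟_ (_∈? sums S) (_∈? sums (p ∷ S)) (sums-mono {S} {p ∷ S} there)
        (upTo (2 * N)) (Unique.map⁺ (+-cancelˡ-≡ p _ _) unique) (map⁺ (All.map new-sum new)))
    where
    new-sum : ∀ {z} → z ∈ p ∷ S × p + z ∉ sums S →
      p + z ∈ upTo (2 * N) × p + z ∈ sums (p ∷ S) × p + z ∉ sums S
    new-sum (z∈ , ∉S+S) = ∈-upTo⁺ (sums-< bounded p+z∈) , p+z∈ , ∉S+S
      where p+z∈ = ∈-sums⁺ (here refl) z∈

module Graph where
  open Plane
  open import Data.Nat as ℕ using (ℕ; suc)
  import Data.Nat.Properties as ℕ
  open import Data.Integer using (ℤ; +_; 0ℤ; _+_; _-_; _*_; -_; _≤_; _<_; _≟_; +≤+; +<+)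
  open import Data.Integer.Properties
    using (pos-+; pos-*; +-injective; *-zeroʳ; *-cancelˡ-≤-pos; +-mono-≤; <⇒≤; <-irrefl; ≮⇒≥;
           _<?_; neg-mono-<; neg-distrib-+; m-n≡m⊖n; ⊖-≥; +-identityʳ; +-comm; ≤-antisym;
           neg-cancel-≤)
  open import Data.List using (List; []; _∷_)
  open import Data.List.Membership.Propositional using (_∈_)
  open import Data.List.Relation.Unary.Any using (here; there)
  open import Data.List.Relation.Unary.All as All using (All; _∷_; all?)
  open import Data.List.Relation.Unary.AllPairs using (AllPairs; _∷_)
  open import Data.Product using (∃-syntax; _×_; _,_; proj₁; proj₂)
  open import Data.Empty using (⊥; ⊥-elim)
  open import Function using (_∘_)
  open import Relation.Nullary using (¬_; yes; no)
  open import Relation.Nullary.Decidable using (map′)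
  open import Relation.Unary using (Decidable)
  open import Relation.Binary.PropositionalEquality
    using (_≡_; _≢_; refl; sym; trans; cong; cong₂; subst)

  private
    0≤-* : ∀ {i j} → 0ℤ ≤ i → 0ℤ ≤ j → 0ℤ ≤ i * j
    0≤-* {+ m} {+ n} _ _ = subst (0ℤ ≤_) (pos-* m n) (+≤+ ℕ.z≤n)

    0≤-cancel : ∀ {k i} → 0ℤ < k → 0ℤ ≤ k * i → 0ℤ ≤ i
    0≤-cancel {+ ℕ.zero} (+<+ ())
    0≤-cancel {+ suc k} {i} _ 0≤ki =
      *-cancelˡ-≤-pos 0ℤ i (+ suc k) (subst (_≤ + suc k * i) (sym (*-zeroʳ (+ suc k))) 0≤ki)

    0≤-sum-zero : ∀ {i j} → 0ℤ ≤ i → 0ℤ ≤ j → i + j ≡ 0ℤ → i ≡ 0ℤ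
    0≤-sum-zero {+ m} {+ n} _ _ m+n≡0 = cong +_ (ℕ.m+n≡0⇒m≡0 m (+-injective m+n≡0))

    0<-diff : ∀ {m n} → m ℕ.< n → 0ℤ < + n - + m
    0<-diff {m} {n} m<n rewrite m-n≡m⊖n n m | ⊖-≥ (ℕ.<⇒≤ m<n) = +<+ (ℕ.m<n⇒0<n∸m m<n)

  module _ (φ : ℕ → ℤ) where

    pt : ℕ → Point
    pt n = (+ n , φ n)

    orient : ℕ → ℕ → ℕ → ℤ
    orient a b c = Δ (pt a) (pt b) (pt c)

    Collinear : List ℕ → Set
    Collinear S = ∀ {a b c} → a ∈ S → b ∈ S → c ∈ S → orient a b c ≡ 0ℤ

    collinear? : Decidable Collinear
    collinear? S = map′
      (λ all a∈ b∈ c∈ → All.lookup (All.lookup (All.lookup all a∈) b∈) c∈)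
      (λ col → All.tabulate λ a∈ → All.tabulate λ b∈ → All.tabulate (col a∈ b∈))
      (all? (λ a → all? (λ b → all? (λ c → orient a b c ≟ 0ℤ) S) S) S)

    FreimanHom : List ℕ → Set
    FreimanHom S = ∀ {r u v w} → r ∈ S → u ∈ S → v ∈ S → w ∈ S →
      r ℕ.+ u ≡ v ℕ.+ w → φ r + φ u ≡ φ v + φ w

    orient-resp-sum : ∀ a b {r u v w} → r ℕ.+ u ≡ v ℕ.+ w → φ r + φ u ≡ φ v + φ w →
      orient a b r + orient a b u ≡ orient a b v + orient a b w
    orient-resp-sum a b {r} {u} {v} {w} x-sum y-sum =
      Δ-resp-⊕ (pt a) (pt b) {pt r} {pt u} {pt v} {pt w}
        (cong₂ _,_ (trans (sym (pos-+ r u)) (trans (cong +_ x-sum) (pos-+ v w))) y-sum)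

    collinear-∷ : ∀ {p S} → Collinear S →
      (∀ {a b} → a ∈ S → b ∈ S → orient a b p ≡ 0ℤ) → Collinear (p ∷ S)
    collinear-∷ {p} col p-on {c = c} (here refl) (here refl) _ = Δ-repeat₁₂ (pt p) (pt c)
    collinear-∷ {p} col p-on {b = b} (here refl) (there _) (here refl) = Δ-repeat₁₃ (pt p) (pt b)
    collinear-∷ {p} col p-on {b = b} {c} (here refl) (there b∈) (there c∈) =
      trans (Δ-cyclic (pt p) (pt b) (pt c)) (p-on b∈ c∈)
    collinear-∷ {p} col p-on {a} (there _) (here refl) (here refl) = Δ-repeat₂₃ (pt a) (pt p)
    collinear-∷ {p} col p-on {a} {c = c} (there a∈) (here refl) (there c∈) =
      trans (Δ-swap (pt a) (pt p) (pt c)) (cong -_ (p-on a∈ c∈))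
    collinear-∷ col p-on (there a∈) (there b∈) (here refl) = p-on a∈ b∈
    collinear-∷ col p-on (there a∈) (there b∈) (there c∈) = col a∈ b∈ c∈

    -- p = r + u − z on the graph, and orientation is affine in its last point
    collinear-∷-sum : ∀ {p S z r u} → Collinear S → z ∈ S → r ∈ S → u ∈ S →
      p ℕ.+ z ≡ r ℕ.+ u → φ p + φ z ≡ φ r + φ u → Collinear (p ∷ S)
    collinear-∷-sum {p} col z∈ r∈ u∈ x-sum y-sum = collinear-∷ col λ {a} {b} a∈ b∈ →
      trans (sym (+-identityʳ (orient a b p)))
        (trans (cong (_+_ (orient a b p)) (sym (col a∈ b∈ z∈)))
          (trans (orient-resp-sum a b x-sum y-sum) (cong₂ _+_ (col a∈ b∈ r∈) (col a∈ b∈ u∈))))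

    collinear-through : ∀ {p w T} → p ≢ w →
      (∀ {z} → z ∈ T → orient p w z ≡ 0ℤ) → Collinear T
    collinear-through {p} {w} {T} p≢w on-pw {a} {b} {c} a∈ b∈ c∈ =
      trans (Δ-cocycle (pt p) (pt a) (pt b) (pt c))
        (cong₂ _+_ (cong₂ _+_ (through a∈ b∈) (through b∈ c∈)) (through c∈ a∈))
      where
      through : ∀ {z z′} → z ∈ T → z′ ∈ T → orient p z z′ ≡ 0ℤ
      through {z} {z′} z∈ z′∈ =
        Δ-through {pt p} {pt w} (pt z) (pt z′) (p≢w ∘ +-injective) (on-pw z∈) (on-pw z′∈)

    -- w is the point of S seen from p at the smallest slope, the nearest one among ties
    Extremal : ℕ → ℕ → List ℕ → Set
    Extremal p w S = ∀ {z} → z ∈ S → 0ℤ ≤ orient p w z × (orient p w z ≡ 0ℤ → w ℕ.≤ z)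

    private
      extremal-at-self : ∀ p q → 0ℤ ≤ orient p q q × (orient p q q ≡ 0ℤ → q ℕ.≤ q)
      extremal-at-self p q =
        subst (0ℤ ≤_) (sym (Δ-repeat₂₃ (pt p) (pt q))) (+≤+ ℕ.z≤n) , λ _ → ℕ.≤-refl

    extremal-exists : ∀ {p S q} → q ∈ S → All (p ℕ.<_) S → AllPairs ℕ._<_ S →
      ∃[ w ] w ∈ S × Extremal p w S
    extremal-exists {p} {q ∷ []} _ _ _ = q , here refl , λ { (here refl) → extremal-at-self p q }
    extremal-exists {p} {q ∷ r ∷ R} _ (p<q ∷ p<R) (q<rR ∷ sorted)
      with extremal-exists (here refl) p<R sorted
    ... | w , w∈ , w-extremal with orient p q w <? 0ℤ
    ... | yes qw<0 = w , there w∈ , λ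
      { (here refl) → <⇒≤ 0<wq , λ wq≡0 → ⊥-elim (<-irrefl (sym wq≡0) 0<wq)
      ; (there z∈)  → w-extremal z∈ }
      where
      0<wq : 0ℤ < orient p w q
      0<wq = subst (0ℤ <_) (sym (Δ-swap (pt p) (pt w) (pt q))) (neg-mono-< qw<0)
    ... | no qw≮0 = q , here refl , λ
      { (here refl) → extremal-at-self p q
      ; (there z∈)  → 0≤qz z∈ , λ _ → ℕ.<⇒≤ (All.lookup q<rR z∈) }
      where
      -- slope(z) ≥ slope(w) ≥ slope(q), via Δ-exchange with the positive factor w − p
      0≤qz : ∀ {z} → z ∈ r ∷ R → 0ℤ ≤ orient p q z
      0≤qz {z} z∈ = 0≤-cancel (0<-diff (All.lookup p<R w∈))
        (subst (0ℤ ≤_) (sym (Δ-exchange (pt p) (pt q) (pt w) (pt z)))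
          (+-mono-≤ (0≤-* (<⇒≤ (0<-diff (All.lookup p<R z∈))) (≮⇒≥ qw≮0))
                    (0≤-* (<⇒≤ (0<-diff p<q)) (proj₁ (w-extremal z∈)))))

    -- r + u = p + w would force r and u onto the ray from p through w, beyond w
    extremal-¬sum : ∀ {p w S r u} → Extremal p w S → p ℕ.< w → r ∈ S → u ∈ S →
      r ℕ.+ u ≡ p ℕ.+ w → φ r + φ u ≡ φ p + φ w → ⊥
    extremal-¬sum {p} {w} {S} {r} {u} w-extremal p<w r∈ u∈ x-sum y-sum =
      ℕ.<⇒≱ (subst (ℕ._< w ℕ.+ w) (sym x-sum) (ℕ.+-monoˡ-< w p<w))
            (ℕ.+-mono-≤ (beyond-w r∈ u∈ r+u≡0) (beyond-w u∈ r∈ u+r≡0))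
      where
      r+u≡0 : orient p w r + orient p w u ≡ 0ℤ
      r+u≡0 = trans (orient-resp-sum p w x-sum y-sum)
        (cong₂ _+_ (Δ-repeat₁₃ (pt p) (pt w)) (Δ-repeat₂₃ (pt p) (pt w)))
      u+r≡0 : orient p w u + orient p w r ≡ 0ℤ
      u+r≡0 = trans (+-comm (orient p w u) (orient p w r)) r+u≡0
      beyond-w : ∀ {z z′} → z ∈ S → z′ ∈ S → orient p w z + orient p w z′ ≡ 0ℤ → w ℕ.≤ z
      beyond-w z∈ z′∈ sum≡0 = proj₂ (w-extremal z∈)
        (0≤-sum-zero (proj₁ (w-extremal z∈)) (proj₁ (w-extremal z′∈)) sum≡0)

  orient-neg : ∀ φ a b c → orient (-_ ∘ φ) a b c ≡ - orient φ a b c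
  orient-neg φ a b c = Δ-reflect (pt φ a) (pt φ b) (pt φ c)

  extremal-both-ways : ∀ {φ p w S} → p ℕ.< w →
    Extremal φ p w S → Extremal (-_ ∘ φ) p w S → Collinear φ (p ∷ S)
  extremal-both-ways {φ} {p} {w} {S} p<w above below = collinear-through φ (ℕ.<⇒≢ p<w) on-pw
    where
    on-pw : ∀ {z} → z ∈ p ∷ S → orient φ p w z ≡ 0ℤ
    on-pw (here refl) = Δ-repeat₁₃ (pt φ p) (pt φ w)
    on-pw {z} (there z∈) = ≤-antisym
      (neg-cancel-≤ (subst (0ℤ ≤_) (orient-neg φ p w z) (proj₁ (below z∈))))
      (proj₁ (above z∈))

  FreimanHom-neg : ∀ {φ S} → FreimanHom φ S → FreimanHom (-_ ∘ φ) S
  FreimanHom-neg {φ} hom {r} {u} {v} {w} r∈ u∈ v∈ w∈ x-sum =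
    trans (sym (neg-distrib-+ (φ r) (φ u)))
      (trans (cong -_ (hom r∈ u∈ v∈ w∈ x-sum)) (neg-distrib-+ (φ v) (φ w)))

  FreimanHom-∷⁻ : ∀ {φ p S} → FreimanHom φ (p ∷ S) → FreimanHom φ S
  FreimanHom-∷⁻ hom r∈ u∈ v∈ w∈ = hom (there r∈) (there u∈) (there v∈) (there w∈)

module Freiman where
  open Sumset
  open Graph
  open import Data.Nat using (ℕ; suc; _+_; _*_; _≤_; _<_; z≤n; s≤s)
  open import Data.Nat.Properties
  open import Data.Nat.Tactic.RingSolver using (solve-∀)
  open import Data.Integer as ℤ using (ℤ)
  open import Data.List using ([]; _∷_; length)
  open import Data.List.Membership.Propositional using (_∈_; _∉_)
  open import Data.List.Relation.Unary.Any using (here; there)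
  open import Data.List.Relation.Unary.All as All using (All; []; _∷_)
  open import Data.List.Relation.Unary.AllPairs as AllPairs using (AllPairs; []; _∷_)
  open import Data.Product using (∃-syntax; _×_; _,_)
  open import Data.Empty using (⊥-elim)
  open import Function using (_∘_)
  open import Relation.Nullary using (¬_; yes; no)
  open import Relation.Binary.PropositionalEquality using (_≡_; _≢_; refl; sym; cong)

  private
    head-≤ : ∀ {q R} → AllPairs _<_ (q ∷ R) → All (q ≤_) (q ∷ R)
    head-≤ (q<R ∷ _) = ≤-refl ∷ All.map <⇒≤ q<R

    double-∉ : ∀ {p S} → All (p <_) S → p + p ∉ sums S
    double-∉ {p} p<S = ∉-sums p<S (+-mono-< (n<1+n p) (n<1+n p))

  sumsetCount-linear : ∀ {N S} → AllPairs _<_ S → All (_< N) S →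
    2 * length S ≤ suc (sumsetCount N S)
  sumsetCount-linear {S = []} _ _ = z≤n
  sumsetCount-linear {N} {p ∷ []} _ bounded =
    s≤s (≤-trans (m≤n+m 1 (sumsetCount N []))
                 (sumsetCount-∷ bounded ([] ∷ []) ((here refl , λ ()) ∷ [])))
  sumsetCount-linear {N} {p ∷ q ∷ R} sorted@((p<q ∷ p<R) ∷ sorted′) bounded@(_ ∷ bounded′) = begin
    2 * suc n          ≡⟨ *-suc 2 n ⟩
    2 + 2 * n          ≤⟨ +-monoʳ-≤ 2 (sumsetCount-linear sorted′ bounded′) ⟩
    2 + suc c          ≡⟨ cong suc (+-comm 2 c) ⟩
    suc (c + 2)        ≤⟨ s≤s (sumsetCount-∷ bounded ((p≢q ∷ []) ∷ [] ∷ []) new) ⟩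
    suc (sumsetCount N (p ∷ q ∷ R)) ∎
    where
    open ≤-Reasoning
    n = length (q ∷ R)
    c = sumsetCount N (q ∷ R)
    p≢q = <⇒≢ p<q
    new : All (λ z → z ∈ p ∷ q ∷ R × p + z ∉ sums (q ∷ R)) (p ∷ q ∷ [])
    new = (here refl , double-∉ (p<q ∷ p<R))
        ∷ (there (here refl) , ∉-sums (head-≤ sorted′) (+-monoˡ-< q p<q)) ∷ []

  module _ (φ : ℕ → ℤ) {p S} (hom : FreimanHom φ (p ∷ S)) where

    collinear-∉ : ∀ {z} → Collinear φ S → ¬ Collinear φ (p ∷ S) → z ∈ S → p + z ∉ sums S
    collinear-∉ col ¬col z∈ p+z∈ with ∈-sums⁻ S p+z∈
    ... | r , u , r∈ , u∈ , p+z≡r+u =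
      ¬col (collinear-∷-sum φ col z∈ r∈ u∈ p+z≡r+u
        (hom (here refl) (there z∈) (there r∈) (there u∈) p+z≡r+u))

    extremal-∉ : ∀ {w} → Extremal φ p w S → p < w → w ∈ S → p + w ∉ sums S
    extremal-∉ w-extremal p<w w∈ p+w∈ with ∈-sums⁻ S p+w∈
    ... | r , u , r∈ , u∈ , p+w≡r+u = extremal-¬sum φ w-extremal p<w r∈ u∈ (sym p+w≡r+u)
      (sym (hom (here refl) (there w∈) (there r∈) (there u∈) p+w≡r+u))

  private
    tail-nonempty : ∀ {φ p S} → ¬ Collinear φ (p ∷ S) → ∃[ q ] q ∈ S
    tail-nonempty {φ} {S = []} ¬col = ⊥-elim (¬col (collinear-∷ φ (λ ()) (λ ())))
    tail-nonempty {S = q ∷ _} _ = q , here refl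

  module _ {φ : ℕ → ℤ} {N p S} (sorted : AllPairs _<_ (p ∷ S)) (bounded : All (_< N) (p ∷ S))
           (hom : FreimanHom φ (p ∷ S)) (¬col : ¬ Collinear φ (p ∷ S)) where

    private
      p<S : All (p <_) S
      p<S = AllPairs.head sorted

    collinear-new-sums : Collinear φ S →
      sumsetCount N S + length (p ∷ S) ≤ sumsetCount N (p ∷ S)
    collinear-new-sums col = sumsetCount-∷ bounded (AllPairs.map <⇒≢ sorted) (All.tabulate new)
      where
      new : ∀ {z} → z ∈ p ∷ S → z ∈ p ∷ S × p + z ∉ sums S
      new (here refl) = here refl , double-∉ p<S
      new (there z∈) = there z∈ , collinear-∉ φ hom col ¬col z∈

    -- the two tangents from p to the rest give two new sums besides p + p
    noncollinear-new-sums : sumsetCount N S + 3 ≤ sumsetCount N (p ∷ S)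
    noncollinear-new-sums with tail-nonempty {φ} ¬col
    ... | q , q∈ with extremal-exists φ q∈ p<S (AllPairs.tail sorted)
                    | extremal-exists (ℤ.-_ ∘ φ) q∈ p<S (AllPairs.tail sorted)
    ... | w₁ , w₁∈ , lowest | w₂ , w₂∈ , highest = sumsetCount-∷ bounded unique new
      where
      p<w₁ : p < w₁
      p<w₁ = All.lookup p<S w₁∈
      p<w₂ : p < w₂
      p<w₂ = All.lookup p<S w₂∈
      w₁≢w₂ : w₁ ≢ w₂
      w₁≢w₂ refl = ¬col (extremal-both-ways {φ} p<w₁ lowest highest)
      unique : AllPairs _≢_ (p ∷ w₁ ∷ w₂ ∷ [])
      unique = (<⇒≢ p<w₁ ∷ <⇒≢ p<w₂ ∷ []) ∷ (w₁≢w₂ ∷ []) ∷ [] ∷ []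
      new : All (λ z → z ∈ p ∷ S × p + z ∉ sums S) (p ∷ w₁ ∷ w₂ ∷ [])
      new = (here refl , double-∉ p<S)
          ∷ (there w₁∈ , extremal-∉ φ hom lowest p<w₁ w₁∈)
          ∷ (there w₂∈ , extremal-∉ (ℤ.-_ ∘ φ) (FreimanHom-neg {φ} hom) highest p<w₂ w₂∈) ∷ []

  private
    split-3n : ∀ n → 3 * suc n ≡ 2 * n + (suc n + 2)
    split-3n = solve-∀
    regroup : ∀ n c → suc c + (suc n + 2) ≡ c + suc n + 3
    regroup = solve-∀
    3n+3 : ∀ n → 3 * suc n ≡ 3 * n + 3
    3n+3 = solve-∀

  freiman-3k-3 : ∀ {φ N S} → AllPairs _<_ S → All (_< N) S → FreimanHom φ S → ¬ Collinear φ S →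
    3 * length S ≤ sumsetCount N S + 3
  freiman-3k-3 {S = []} _ _ _ _ = z≤n
  freiman-3k-3 {φ} {N} {p ∷ S} sorted bounded hom ¬col with collinear? φ S
  ... | yes col = begin
    3 * suc n                  ≡⟨ split-3n n ⟩
    2 * n + (suc n + 2)        ≤⟨ +-monoˡ-≤ (suc n + 2) (sumsetCount-linear sorted′ bounded′) ⟩
    suc c + (suc n + 2)        ≡⟨ regroup n c ⟩
    c + suc n + 3              ≤⟨ +-monoˡ-≤ 3 (collinear-new-sums {φ} sorted bounded hom ¬col col) ⟩
    sumsetCount N (p ∷ S) + 3  ∎
    where
    open ≤-Reasoning
    n = length S
    c = sumsetCount N S
    sorted′ = AllPairs.tail sorted
    bounded′ = All.tail bounded
  ... | no ¬col′ = begin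
    3 * suc n                  ≡⟨ 3n+3 n ⟩
    3 * n + 3                  ≤⟨ +-monoˡ-≤ 3 (freiman-3k-3 {φ} sorted′ bounded′ hom′ ¬col′) ⟩
    c + 3 + 3                  ≤⟨ +-monoˡ-≤ 3 (noncollinear-new-sums {φ} sorted bounded hom ¬col) ⟩
    sumsetCount N (p ∷ S) + 3  ∎
    where
    open ≤-Reasoning
    n = length S
    c = sumsetCount N S
    sorted′ = AllPairs.tail sorted
    bounded′ = All.tail bounded
    hom′ = FreimanHom-∷⁻ {φ} hom

  small-doubling⇒collinear : ∀ {φ N S} → AllPairs _<_ S → All (_< N) S → FreimanHom φ S →
    6 ≤ length S → 2 * sumsetCount N S < 5 * length S → Collinear φ S
  small-doubling⇒collinear {φ} {N} {S} sorted bounded hom 6≤k small with collinear? φ S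
  ... | yes col = col
  ... | no ¬col = ⊥-elim (<⇒≱ (+-cancelˡ-< (5 * k) k 6 (begin-strict
    5 * k + k               ≡⟨ six-fold k ⟩
    2 * (3 * k)             ≤⟨ *-monoʳ-≤ 2 (freiman-3k-3 {φ} sorted bounded hom ¬col) ⟩
    2 * (c + 3)             ≡⟨ *-distribˡ-+ 2 c 3 ⟩
    2 * c + 6               <⟨ +-monoˡ-< 6 small ⟩
    5 * k + 6               ∎)) 6≤k)
    where
    open ≤-Reasoning
    k = length S
    c = sumsetCount N S
    six-fold : ∀ n → 5 * n + n ≡ 2 * (3 * n)
    six-fold = solve-∀

module Multiples where
  open import Data.Nat as ℕ using (ℕ)
  open import Data.Nat.GCD using (gcd; gcd-GCD; module Bézout)
  open import Data.Integer using (ℤ; +_; 0ℤ; _+_; _-_; _*_)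
  open import Data.Integer.Properties using (pos-+; pos-*; *-zeroˡ; *-assoc)
  open import Data.Integer.Tactic.RingSolver using (solve-∀)
  open import Data.List using ([]; _∷_)
  open import Data.List.Relation.Unary.All using (All; []; _∷_)
  open import Data.Product using (∃-syntax; _,_)
  open import Relation.Binary.PropositionalEquality
    using (_≡_; sym; trans; cong; cong₂; module ≡-Reasoning)

  bézout-combination : ∀ {d x m y n u v zm zn} → d + y * n ≡ x * m →
    m * u ≡ zm * v → n * u ≡ zn * v → d * u ≡ (x * zm - y * zn) * v
  bézout-combination {d} {x} {m} {y} {n} {u} {v} {zm} {zn} bézout mu nu = begin
    d * u                           ≡⟨ split d y n u ⟩
    (d + y * n) * u - y * (n * u)   ≡⟨ cong (λ k → k * u - y * (n * u)) bézout ⟩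
    x * m * u - y * (n * u)         ≡⟨ cong (_- y * (n * u)) (*-assoc x m u) ⟩
    x * (m * u) - y * (n * u)       ≡⟨ cong₂ (λ k l → x * k - y * l) mu nu ⟩
    x * (zm * v) - y * (zn * v)     ≡⟨ collect x zm v y zn ⟩
    (x * zm - y * zn) * v           ∎
    where
    open ≡-Reasoning
    split : ∀ d y n u → d * u ≡ (d + y * n) * u - y * (n * u)
    split = solve-∀
    collect : ∀ x zm v y zn → x * (zm * v) - y * (zn * v) ≡ (x * zm - y * zn) * v
    collect = solve-∀

  module _ {J : Set} (u v : J → ℤ) where

    ScalesTo : ℕ → Set
    ScalesTo d = ∃[ z ] ∀ j → + d * u j ≡ z * v j

    scalesTo-0 : ScalesTo 0
    scalesTo-0 = 0ℤ , λ j → trans (*-zeroˡ (u j)) (sym (*-zeroˡ (v j)))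

    scalesTo-bézout : ∀ {d m n} x y → d ℕ.+ y ℕ.* n ≡ x ℕ.* m →
      ScalesTo m → ScalesTo n → ScalesTo d
    scalesTo-bézout {d} {m} {n} x y eq (zm , m-scales) (zn , n-scales) =
      + x * zm - + y * zn , λ j →
        bézout-combination {+ d} {+ x} {+ m} {+ y} {+ n} {u j} {v j} int-eq (m-scales j) (n-scales j)
      where
      int-eq : + d + + y * + n ≡ + x * + m
      int-eq = trans (cong (_+_ (+ d)) (sym (pos-* y n)))
        (trans (sym (pos-+ d (y ℕ.* n))) (trans (cong +_ eq) (pos-* x m)))

    scalesTo-gcd : ∀ {m n} → ScalesTo m → ScalesTo n → ScalesTo (gcd m n)
    scalesTo-gcd {m} {n} m-scales n-scales with Bézout.identity (gcd-GCD m n)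
    ... | Bézout.+- x y eq = scalesTo-bézout x y eq m-scales n-scales
    ... | Bézout.-+ x y eq = scalesTo-bézout y x eq n-scales m-scales

    scalesTo-gcdList : ∀ {ds} → All ScalesTo ds → ScalesTo (gcdList ds)
    scalesTo-gcdList [] = scalesTo-0
    scalesTo-gcdList {d ∷ ds} (d-scales ∷ ds-scale) =
      scalesTo-gcd {d} {gcdList ds} d-scales (scalesTo-gcdList ds-scale)

module Enumeration where
  open Plane using (Δ-origin)
  open Sumset
  open Graph
  open Multiples
  open import Data.Nat using (ℕ; _+_; _*_; _<_; _≤_; _≟_)
  open import Data.Nat.Properties using (≤-trans; ≤∧≢⇒<; ≤-decTotalOrder)
  open import Data.Fin using (Fin)
  open import Data.Fin.Properties using (any?)
  open import Data.Integer as ℤ using (ℤ; +_; 0ℤ)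
  open import Data.Integer.Properties using (i-j≡0⇒i≡j; *-comm; *-identityˡ; pos-+)
  open import Data.Integer.Tactic.RingSolver using (solve-∀)
  open import Data.List using (List; map; length; allFin; upTo)
  open import Data.List.Properties using (length-map; length-tabulate)
  open import Data.List.Membership.Propositional using (_∈_)
  open import Data.List.Membership.Propositional.Properties using (∈-map⁺; ∈-map⁻; ∈-allFin)
  open import Data.List.Relation.Unary.All as All using (All)
  open import Data.List.Relation.Unary.AllPairs as AllPairs using (AllPairs)
  open import Data.List.Relation.Unary.Linked.Properties using (Linked⇒AllPairs)
  import Data.List.Relation.Unary.Unique.Propositional.Properties as Unique
  open import Data.List.Relation.Binary.Permutation.Propositional using (↭-sym; ↭⇒↭ₛ)
  open import Data.List.Relation.Binary.Permutation.Propositional.Properties using (∈-resp-↭; ↭-length)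
  open import Data.List.Sort ≤-decTotalOrder using (sort; sort-↭; sort-↗)
  open import Data.Product using (∃-syntax; _,_; uncurry)
  open import Data.Empty using (⊥-elim)
  open import Function using (id)
  open import Function.Definitions using (Injective)
  open import Relation.Nullary using (yes; no)
  open import Relation.Binary.PropositionalEquality
    using (_≡_; refl; sym; trans; cong; cong₂; subst; setoid; module ≡-Reasoning)
  open import Data.List.Relation.Binary.Permutation.Setoid.Properties (setoid ℕ) using (Unique-resp-↭)

  private
    sum⇒diff : ∀ i j k l → i ℤ.+ j ≡ k ℤ.+ l → i ℤ.- l ≡ k ℤ.- j
    sum⇒diff i j k l eq = trans (regroupˡ i j l) (trans (cong (ℤ._- (j ℤ.+ l)) eq) (regroupʳ k l j))
      where
      regroupˡ : ∀ i j l → i ℤ.- l ≡ (i ℤ.+ j) ℤ.- (j ℤ.+ l)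
      regroupˡ = solve-∀
      regroupʳ : ∀ k l j → (k ℤ.+ l) ℤ.- (j ℤ.+ l) ≡ k ℤ.- j
      regroupʳ = solve-∀

    diff⇒sum : ∀ i j k l → i ℤ.- l ≡ k ℤ.- j → i ℤ.+ j ≡ k ℤ.+ l
    diff⇒sum i j k l eq = trans (regroupˡ i j l) (trans (cong (ℤ._+ (j ℤ.+ l)) eq) (regroupʳ k l j))
      where
      regroupˡ : ∀ i j l → i ℤ.+ j ≡ (i ℤ.- l) ℤ.+ (j ℤ.+ l)
      regroupˡ = solve-∀
      regroupʳ : ∀ k l j → (k ℤ.- j) ℤ.+ (j ℤ.+ l) ≡ k ℤ.+ l
      regroupʳ = solve-∀

  module _ {s : ℕ} (a : Fin s → ℕ) where

    elements : List ℕ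
    elements = sort (map a (allFin s))

    ∈-elements⁺ : ∀ i → a i ∈ elements
    ∈-elements⁺ i = ∈-resp-↭ (↭-sym (sort-↭ _)) (∈-map⁺ a (∈-allFin i))

    ∈-elements⁻ : ∀ {n} → n ∈ elements → ∃[ i ] n ≡ a i
    ∈-elements⁻ n∈ with ∈-map⁻ a (∈-resp-↭ (sort-↭ _) n∈)
    ... | i , _ , n≡ai = i , n≡ai

    elements-bounded : ∀ {N} → (∀ i → a i < N) → All (_< N) elements
    elements-bounded {N} a<N = All.tabulate λ n∈ →
      let i , n≡ai = ∈-elements⁻ n∈ in subst (_< N) (sym n≡ai) (a<N i)

    sumsetCount-elements : ∀ N → sumsetCount N elements ≤ sumsetSize N a
    sumsetCount-elements N = FilterLength.length-filter-mono _ (inSumset? a) in-sumset (upTo (2 * N))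
      where
      in-sumset : ∀ {n} → n ∈ sums elements → InSumset a n
      in-sumset n∈ with ∈-sums⁻ elements n∈
      ... | r , u , r∈ , u∈ , refl with ∈-elements⁻ r∈ | ∈-elements⁻ u∈
      ... | i , refl | j , refl = i , j , refl

    -- x read as a function on A; its values off A are never used
    valueAt : (Fin s → ℤ) → ℕ → ℤ
    valueAt x n with any? (λ i → a i ≟ n)
    ... | yes (i , _) = x i
    ... | no _ = 0ℤ

    module _ (a-injective : Injective _≡_ _≡_ a) where

      length-elements : length elements ≡ s
      length-elements =
        trans (↭-length (sort-↭ _)) (trans (length-map a (allFin s)) (length-tabulate id))

      elements-sorted : AllPairs _<_ elements
      elements-sorted = AllPairs.map (uncurry ≤∧≢⇒<) (AllPairs.zip
        ( Linked⇒AllPairs ≤-trans (sort-↗ _)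
        , Unique-resp-↭ (↭⇒↭ₛ (↭-sym (sort-↭ _))) (Unique.map⁺ a-injective (Unique.allFin⁺ s))))

      module _ (x : Fin s → ℤ) where

        valueAt-a : ∀ i → valueAt x (a i) ≡ x i
        valueAt-a i with any? (λ j → a j ≟ a i)
        ... | yes (j , aj≡ai) = cong x (a-injective aj≡ai)
        ... | no ∄j = ⊥-elim (∄j (i , refl))

        valueAt-hom :
          (∀ i j k l → + a j ℤ.- + a i ≡ + a k ℤ.- + a l → x j ℤ.- x i ≡ x k ℤ.- x l) →
          FreimanHom (valueAt x) elements
        valueAt-hom preserves r∈ u∈ v∈ w∈ r+u≡v+w
          with ∈-elements⁻ r∈ | ∈-elements⁻ u∈ | ∈-elements⁻ v∈ | ∈-elements⁻ w∈
        ... | i , refl | j , refl | k , refl | l , refl = begin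
          valueAt x (a i) ℤ.+ valueAt x (a j)  ≡⟨ cong₂ ℤ._+_ (valueAt-a i) (valueAt-a j) ⟩
          x i ℤ.+ x j                          ≡⟨ diff⇒sum (x i) (x j) (x k) (x l) x-diff ⟩
          x k ℤ.+ x l                          ≡⟨ sym (cong₂ ℤ._+_ (valueAt-a k) (valueAt-a l)) ⟩
          valueAt x (a k) ℤ.+ valueAt x (a l)  ∎
          where
          open ≡-Reasoning
          x-diff : x i ℤ.- x l ≡ x k ℤ.- x j
          x-diff = preserves l i k j (sum⇒diff (+ a i) (+ a j) (+ a k) (+ a l)
            (trans (sym (pos-+ (a i) (a j))) (trans (cong +_ r+u≡v+w) (pos-+ (a k) (a l)))))

        module _ {i₀ : Fin s} (a-i₀≡0 : a i₀ ≡ 0) (collinear : Collinear (valueAt x) elements) where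

          scalesTo-elements : ∀ {d} → d ∈ elements → ScalesTo (λ j → x j ℤ.- x i₀) (λ j → + a j) d
          scalesTo-elements d∈ with ∈-elements⁻ d∈
          ... | i , refl = x i ℤ.- x i₀ , λ j → begin
            + a i ℤ.* (x j ℤ.- x i₀)
              ≡⟨ cong₂ (λ y₀ yⱼ → + a i ℤ.* (yⱼ ℤ.- y₀)) (sym y-0) (sym (valueAt-a j)) ⟩
            + a i ℤ.* (y (a j) ℤ.- y 0)
              ≡⟨ i-j≡0⇒i≡j _ _ (trans (sym (Δ-origin (y 0) (+ a i) (y (a i)) (+ a j) (y (a j))))
                                      (collinear 0∈ (∈-elements⁺ i) (∈-elements⁺ j))) ⟩
            + a j ℤ.* (y (a i) ℤ.- y 0)
              ≡⟨ cong₂ (λ y₀ yᵢ → + a j ℤ.* (yᵢ ℤ.- y₀)) y-0 (valueAt-a i) ⟩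
            + a j ℤ.* (x i ℤ.- x i₀)
              ≡⟨ *-comm (+ a j) (x i ℤ.- x i₀) ⟩
            (x i ℤ.- x i₀) ℤ.* + a j ∎
            where
            open ≡-Reasoning
            y : ℕ → ℤ
            y = valueAt x
            0∈ : 0 ∈ elements
            0∈ = subst (_∈ elements) a-i₀≡0 (∈-elements⁺ i₀)
            y-0 : y 0 ≡ x i₀
            y-0 = trans (cong y (sym a-i₀≡0)) (valueAt-a i₀)

          affine : ∀ {ds} → All (_∈ elements) ds → gcdList ds ≡ 1 →
            ∃[ X ] ∃[ Y ] ∀ j → x j ≡ + a j ℤ.* X ℤ.+ Y
          affine ds∈ gcd≡1
            with subst (ScalesTo _ _) gcd≡1 (scalesTo-gcdList _ _ (All.map scalesTo-elements ds∈))
          ... | z , scales = z , x i₀ , λ j → begin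
            x j                          ≡⟨ sub-add (x j) (x i₀) ⟩
            (x j ℤ.- x i₀) ℤ.+ x i₀      ≡⟨ cong (ℤ._+ x i₀) (trans (sym (*-identityˡ _)) (scales j)) ⟩
            z ℤ.* + a j ℤ.+ x i₀         ≡⟨ cong (ℤ._+ x i₀) (*-comm z (+ a j)) ⟩
            + a j ℤ.* z ℤ.+ x i₀         ∎
            where
            open ≡-Reasoning
            sub-add : ∀ u v → u ≡ (u ℤ.- v) ℤ.+ v
            sub-add = solve-∀

open import Data.Nat using (ℕ; suc; _<_; _≤_; _*_)
open import Data.Fin using (Fin; zero; suc)
open import Data.List using (map; allFin)
open import Data.Integer using (ℤ; +_; _-_; _+_) renaming (_*_ to _*ℤ_)
open import Data.Product using (∃-syntax)
open import Function.Definitions using (Injective)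
open import Relation.Binary.PropositionalEquality using (_≡_)

open import Data.Nat using (s≤s)
open import Data.List using (length)
open import Data.Nat.Properties using (*-monoʳ-≤; ≤-<-trans)
open import Data.List.Relation.Unary.All.Properties using (map⁺; tabulate⁺)
open import Relation.Binary.PropositionalEquality using (sym; subst)
open import Function using (_∘_)
open Sumset using (sumsetCount)
open Graph using (Collinear)
open Freiman using (small-doubling⇒collinear)
open Enumeration

theorem7 : (t N : ℕ) → 5 ≤ t → 1 ≤ N →
    (a : Fin (suc t) → ℕ) →
    Injective _≡_ _≡_ a →
    a zero ≡ 0 →
    (∀ i → a i < N) →
    gcdList (map (λ i → a (suc i)) (allFin t)) ≡ 1 →
    (x : Fin (suc t) → ℤ) →
    (∀ i j k l → (+ a j) - (+ a i) ≡ (+ a k) - (+ a l) → x j - x i ≡ x k - x l) →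
    2 * sumsetSize N a < 5 * suc t →
    ∃[ X ] ∃[ Y ] (∀ i → x i ≡ ((+ a i) *ℤ X) + Y)
theorem7 t N 5≤t _ a a-injective a₀≡0 a<N gcd≡1 x preserves small =
  affine a a-injective x a₀≡0 collinear (map⁺ (tabulate⁺ (∈-elements⁺ a ∘ suc))) gcd≡1
  where
  size : length (elements a) ≡ suc t
  size = length-elements a a-injective
  small′ : 2 * sumsetCount N (elements a) < 5 * length (elements a)
  small′ = subst (λ k → 2 * sumsetCount N (elements a) < 5 * k) (sym size)
    (≤-<-trans (*-monoʳ-≤ 2 (sumsetCount-elements a N)) small)
  collinear : Collinear (valueAt a x) (elements a)
  collinear = small-doubling⇒collinear {valueAt a x}
    (elements-sorted a a-injective) (elements-bounded a a<N) (valueAt-hom a a-injective x preserves)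
    (subst (6 ≤_) (sym size) (s≤s 5≤t)) small′
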